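{- Every countable lattice has the selection property for convex sublattices (CLSP).
   Context: For a lattice $T$, $\mathcal{C}_L(T)$ is the set of nonempty convex sublattices of $T$ ordered by the bi-dominating order: $X\le Y$ iff every element of $X$ is below some element of $Y$ and every element of $Y$ is above some element of $X$. $T$ has CLSP if there is an order preserving map $\varphi:\mathcal{C}_L(T)\to T$ with $\varphi(S)\in S$ for all $S\in\mathcal{C}_L(T)$. -}

module Defs where

open import Level using (0ℓ)
open import Data.Nat using (ℕ)
open import Data.Product using (Σ; ∃; _×_; _,_; proj₁)
open import Relation.Binary.PropositionalEquality using (_≡_)
open import Relation.Binary.Lattice using (Lattice)

module _ (L : Lattice 0ℓ 0ℓ 0ℓ) where
  open Lattice L

  Subset : Set₁
  Subset = Carrier → Set

  record IsConvexSublattice (S : Subset) : Set where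
    field
      nonempty : ∃ λ x → S x
      ∨-closed : ∀ {x y} → S x → S y → S (x ∨ y)
      ∧-closed : ∀ {x y} → S x → S y → S (x ∧ y)
      convex   : ∀ {a b x} → S a → S b → a ≤ x → x ≤ b → S x

  CL : Set₁
  CL = Σ Subset IsConvexSublattice

  _⊑_ : CL → CL → Set
  (X , _) ⊑ (Y , _) =
    (∀ x → X x → ∃ λ y → Y y × x ≤ y) ×
    (∀ y → Y y → ∃ λ x → X x × x ≤ y)

  HasCLSP : Set₁
  HasCLSP = Σ (CL → Carrier) λ (φ : CL → Carrier) →
    (∀ (S : CL) → proj₁ S (φ S)) × (∀ (S T : CL) → S ⊑ T → φ S ≤ φ T)

  Countable : Set
  Countable = Σ (Carrier → ℕ) λ f → ∀ x y → f x ≡ f y → x ≈ y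

-- Enumerate L as x₀, x₁, …. For a convex sublattice S let lower S k be the meet of those
-- xᵢ (i < k) lying above some element of S, and upper S k the join of those lying below
-- some element of S, both computed in L with a new top and bottom added. A choice point
-- is carried along by clamping it into [lower S k, upper S k] at every step. As soon as
-- some element y of S has been enumerated, lower S k ≤ y ≤ upper S k, both bounds lie in
-- S by convexity, and the bounds only widen from then on, so the clamped point never
-- moves again and lies in S. If S ⊑ T then every bound for S lies below the matching
-- bound for T, and clamping is monotone, so the limits are ordered too.
module Submission where

open import Defs
open import Level using (0ℓ; _⊔_)
open import Axiom.ExcludedMiddle using (ExcludedMiddle)
open import Data.Empty using (⊥)
open import Data.Maybe using (Maybe; just; nothing)
open import Data.Nat using (ℕ; zero; suc; _≤′_; ≤′-refl; ≤′-step) renaming (_⊔_ to _⊔ℕ_)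
open import Data.Nat.Properties using (m≤m⊔n; m≤n⊔m; ≤⇒≤′)
open import Data.Product using (Σ; ∃; ∃₂; _×_; _,_; proj₁; proj₂)
open import Data.Unit using (⊤)
open import Function using (_∘_)
open import Relation.Binary.Lattice using (Lattice; Supremum; Infimum)
open import Relation.Binary.PropositionalEquality using (_≡_; refl)
open import Relation.Nullary using (Dec; yes; no; contradiction)
open import Relation.Nullary.Construct.Add.Extrema using (_±; ⊥±; ⊤±; [_])
open import Relation.Unary using (Pred; Decidable; _⊆_)
import Relation.Binary.Construct.Add.Extrema.Equality as ExtremaEquality
import Relation.Binary.Construct.Add.Extrema.NonStrict as ExtremaNonStrict
import Relation.Binary.Lattice.Properties.JoinSemilattice as JoinSemilatticeProperties
import Relation.Binary.Lattice.Properties.MeetSemilattice as MeetSemilatticeProperties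
import Relation.Binary.Lattice.Properties.Lattice as LatticeProperties
import Relation.Binary.Reasoning.PartialOrder as PartialOrderReasoning

module AddExtrema {c ℓ₁ ℓ₂} (L : Lattice c ℓ₁ ℓ₂) where
  open Lattice L renaming (refl to ≤-refl)
  open ExtremaEquality _≈_ using (_≈±_)
  open ExtremaNonStrict _≤_ using (_≤±_; ⊥±≤_; _≤⊤±; ⊥±≤[_]; [_]≤⊤±; ≤±-isPartialOrder)
    renaming ([_] to ≤[_])

  infixr 6 _∨±_
  infixr 7 _∧±_

  _∨±_ : Carrier ± → Carrier ± → Carrier ±
  ⊥±    ∨± y     = y
  ⊤±    ∨± y     = ⊤±
  [ x ] ∨± ⊥±    = [ x ]
  [ x ] ∨± [ y ] = [ x ∨ y ]
  [ x ] ∨± ⊤±    = ⊤±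

  _∧±_ : Carrier ± → Carrier ± → Carrier ±
  ⊤±    ∧± y     = y
  ⊥±    ∧± y     = ⊥±
  [ x ] ∧± ⊤±    = [ x ]
  [ x ] ∧± [ y ] = [ x ∧ y ]
  [ x ] ∧± ⊥±    = ⊥±

  ≤±-refl : ∀ {x} → x ≤± x
  ≤±-refl {⊥±}    = ⊥±≤ ⊥±
  ≤±-refl {[ x ]} = ≤[ ≤-refl ]
  ≤±-refl {⊤±}    = ⊤± ≤⊤±

  ∨±-supremum : Supremum _≤±_ _∨±_
  ∨±-supremum ⊥±    y     = ⊥±≤ y , ≤±-refl , λ _ _ y≤z → y≤z
  ∨±-supremum ⊤±    y     = ⊤± ≤⊤± , y ≤⊤± , λ _ ⊤≤z _ → ⊤≤z
  ∨±-supremum [ x ] ⊥±    = ≤±-refl , ⊥±≤ [ x ] , λ _ x≤z _ → x≤z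
  ∨±-supremum [ x ] ⊤±    = [ x ] ≤⊤± , ⊤± ≤⊤± , λ _ _ ⊤≤z → ⊤≤z
  ∨±-supremum [ x ] [ y ] = ≤[ x≤x∨y x y ] , ≤[ y≤x∨y x y ] , least
    where
    least : ∀ z → [ x ] ≤± z → [ y ] ≤± z → [ x ∨ y ] ≤± z
    least _ ≤[ x≤z ]   ≤[ y≤z ] = ≤[ ∨-least x≤z y≤z ]
    least _ [ _ ]≤⊤± _          = [ x ∨ y ] ≤⊤±

  ∧±-infimum : Infimum _≤±_ _∧±_
  ∧±-infimum ⊤±    y     = y ≤⊤± , ≤±-refl , λ _ _ z≤y → z≤y
  ∧±-infimum ⊥±    y     = ⊥±≤ ⊥± , ⊥±≤ y , λ _ z≤⊥ _ → z≤⊥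
  ∧±-infimum [ x ] ⊤±    = ≤±-refl , [ x ] ≤⊤± , λ _ z≤x _ → z≤x
  ∧±-infimum [ x ] ⊥±    = ⊥±≤ [ x ] , ⊥±≤ ⊥± , λ _ _ z≤⊥ → z≤⊥
  ∧±-infimum [ x ] [ y ] = ≤[ x∧y≤x x y ] , ≤[ x∧y≤y x y ] , greatest
    where
    greatest : ∀ z → z ≤± [ x ] → z ≤± [ y ] → z ≤± [ x ∧ y ]
    greatest _ ≤[ z≤x ]   ≤[ z≤y ] = ≤[ ∧-greatest z≤x z≤y ]
    greatest _ ⊥±≤[ _ ] _          = ⊥±≤ [ x ∧ y ]

  lattice± : Lattice c (c ⊔ ℓ₁) (c ⊔ ℓ₂)
  lattice± = record
    { Carrier   = Carrier ±
    ; _≈_       = _≈±_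
    ; _≤_       = _≤±_
    ; _∨_       = _∨±_
    ; _∧_       = _∧±_
    ; isLattice = record
      { isPartialOrder = ≤±-isPartialOrder isPartialOrder
      ; supremum       = ∨±-supremum
      ; infimum        = ∧±-infimum
      }
    }

module Clamp {c ℓ₁ ℓ₂} (M : Lattice c ℓ₁ ℓ₂) where
  open Lattice M renaming (refl to ≤-refl)
  open JoinSemilatticeProperties joinSemilattice using (∨-monotonic)
  open MeetSemilatticeProperties meetSemilattice using (∧-monotonic)

  clamp : Carrier → Carrier → Carrier → Carrier
  clamp l u p = (p ∨ l) ∧ u

  clamp-monotonic : ∀ {l l' u u' p p'} → l ≤ l' → u ≤ u' → p ≤ p' → clamp l u p ≤ clamp l' u' p'
  clamp-monotonic l≤l' u≤u' p≤p' = ∧-monotonic (∨-monotonic p≤p' l≤l') u≤u'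

  ≤-clamp : ∀ {l u} p → l ≤ u → l ≤ clamp l u p
  ≤-clamp {l} p l≤u = ∧-greatest (y≤x∨y p l) l≤u

  clamp-≤ : ∀ l u p → clamp l u p ≤ u
  clamp-≤ l u p = x∧y≤y (p ∨ l) u

  clamp-fixes : ∀ {l u p} → l ≤ p → p ≤ u → clamp l u p ≈ p
  clamp-fixes {l} {u} {p} l≤p p≤u =
    antisym (trans (x∧y≤x (p ∨ l) u) (∨-least ≤-refl l≤p)) (∧-greatest (x≤x∨y p l) p≤u)

  clampIterate : Carrier → (ℕ → Carrier) → (ℕ → Carrier) → ℕ → Carrier
  clampIterate p₀ l u zero    = p₀
  clampIterate p₀ l u (suc k) = clamp (l (suc k)) (u (suc k)) (clampIterate p₀ l u k)

  clampIterate-monotonic : ∀ {p₀ p₀' l l' u u'} → p₀ ≤ p₀' →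
                           (∀ k → l k ≤ l' k) → (∀ k → u k ≤ u' k) →
                           ∀ k → clampIterate p₀ l u k ≤ clampIterate p₀' l' u' k
  clampIterate-monotonic p₀≤p₀' l≤l' u≤u' zero    = p₀≤p₀'
  clampIterate-monotonic p₀≤p₀' l≤l' u≤u' (suc k) =
    clamp-monotonic (l≤l' (suc k)) (u≤u' (suc k)) (clampIterate-monotonic p₀≤p₀' l≤l' u≤u' k)

  module Bracketed {p₀ : Carrier} {l u : ℕ → Carrier}
                   (l-decreasing : ∀ k → l (suc k) ≤ l k) (u-increasing : ∀ k → u k ≤ u (suc k))
                   {n : ℕ} (ordered : l (suc n) ≤ u (suc n)) where

    private
      p : ℕ → Carrier
      p = clampIterate p₀ l u

    clampIterate-between : ∀ {k} → suc n ≤′ k → l k ≤ p k × p k ≤ u k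
    clampIterate-between ≤′-refl = ≤-clamp (p n) ordered , clamp-≤ _ _ (p n)
    clampIterate-between {suc k} (≤′-step n<k) = ≤-clamp (p k) l≤u , clamp-≤ _ _ (p k)
      where
      l≤u : l (suc k) ≤ u (suc k)
      l≤u = let l≤p , p≤u = clampIterate-between n<k in
        trans (l-decreasing k) (trans l≤p (trans p≤u (u-increasing k)))

    clampIterate-stable : ∀ {k} → suc n ≤′ k → p k ≈ p (suc n)
    clampIterate-stable ≤′-refl = Eq.refl
    clampIterate-stable {suc k} (≤′-step n<k) =
      let l≤p , p≤u = clampIterate-between n<k in
      Eq.trans (clamp-fixes (trans (l-decreasing k) l≤p) (trans p≤u (u-increasing k)))
               (clampIterate-stable n<k)

module RunningMeet {a c ℓ₁ ℓ₂} (M : Lattice c ℓ₁ ℓ₂) {A : Set a}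
                   (ι : A → Lattice.Carrier M) (m₀ : Lattice.Carrier M) (xs : ℕ → Maybe A) where
  open Lattice M renaming (refl to ≤-refl)
  open MeetSemilatticeProperties meetSemilattice using (∧-monotonic)

  module _ {p} {P : Pred A p} (P? : Decidable P) where

    meetStep : Carrier → Maybe A → Carrier
    meetStep m nothing = m
    meetStep m (just x) with P? x
    ... | yes _ = m ∧ ι x
    ... | no _  = m

    runningMeet : ℕ → Carrier
    runningMeet zero    = m₀
    runningMeet (suc n) = meetStep (runningMeet n) (xs n)

    runningMeet-decreasing : ∀ n → runningMeet (suc n) ≤ runningMeet n
    runningMeet-decreasing n with xs n
    ... | nothing = ≤-refl
    ... | just x with P? x
    ...   | yes _ = x∧y≤x _ _
    ...   | no _  = ≤-refl

    runningMeet-≤ : ∀ {n x} → xs n ≡ just x → P x → runningMeet (suc n) ≤ ι x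
    runningMeet-≤ {n} {x} xsₙ≡x Px with xs n | xsₙ≡x
    ... | just x | refl with P? x
    ...   | yes _  = x∧y≤y _ _
    ...   | no ¬Px = contradiction Px ¬Px

    runningMeet-induction : ∀ {r} (R : Pred Carrier r) → R m₀ →
                            (∀ {m x} → R m → P x → R (m ∧ ι x)) →
                            ∀ n → R (runningMeet n)
    runningMeet-induction R R₀ R-step zero = R₀
    runningMeet-induction R R₀ R-step (suc n) with xs n
    ... | nothing = runningMeet-induction R R₀ R-step n
    ... | just x with P? x
    ...   | yes Px = R-step (runningMeet-induction R R₀ R-step n) Px
    ...   | no _   = runningMeet-induction R R₀ R-step n

  runningMeet-antitone : ∀ {p q} {P : Pred A p} {Q : Pred A q} (P? : Decidable P) (Q? : Decidable Q) →
                         Q ⊆ P → ∀ n → runningMeet P? n ≤ runningMeet Q? n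
  runningMeet-antitone P? Q? Q⊆P zero = ≤-refl
  runningMeet-antitone P? Q? Q⊆P (suc n) with xs n
  ... | nothing = runningMeet-antitone P? Q? Q⊆P n
  ... | just x with P? x | Q? x
  ...   | yes _  | yes _  = ∧-monotonic (runningMeet-antitone P? Q? Q⊆P n) ≤-refl
  ...   | yes _  | no _   = trans (x∧y≤x _ _) (runningMeet-antitone P? Q? Q⊆P n)
  ...   | no ¬Px | yes Qx = contradiction (Q⊆P Qx) ¬Px
  ...   | no _   | no _   = runningMeet-antitone P? Q? Q⊆P n

module _ (L : Lattice 0ℓ 0ℓ 0ℓ) where
  open Lattice L using (Carrier; _≈_)

  Enumeration : Set
  Enumeration = Σ (ℕ → Maybe Carrier) λ xs → ∀ x → ∃₂ λ n y → xs n ≡ just y × y ≈ x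

  countable⇒enumeration : ExcludedMiddle 0ℓ → Countable L → Enumeration
  countable⇒enumeration em (code , code-injective) = decode ∘ decodable , onto
    where
    decodable : ∀ n → Dec (∃ λ x → code x ≡ n)
    decodable n = em

    decode : ∀ {n} → Dec (∃ λ x → code x ≡ n) → Maybe Carrier
    decode (yes (x , _)) = just x
    decode (no _)        = nothing

    decode-onto : ∀ x (d : Dec (∃ λ y → code y ≡ code x)) → ∃ λ y → decode d ≡ just y × y ≈ x
    decode-onto x (yes (y , code-y≡code-x)) = y , refl , code-injective y x code-y≡code-x
    decode-onto x (no ∄y)                  = contradiction (x , refl) ∄y

    onto : ∀ x → ∃₂ λ n y → decode (decodable n) ≡ just y × y ≈ x
    onto x = code x , decode-onto x (decodable (code x))

module Selection (em : ExcludedMiddle 0ℓ) (L : Lattice 0ℓ 0ℓ 0ℓ) (enumeration : Enumeration L) where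
  open Lattice L renaming (refl to ≤-refl)
  open AddExtrema L using (lattice±; _∧±_; _∨±_)
  open ExtremaEquality _≈_ using (_≈±_)
  open ExtremaNonStrict _≤_ using (_≤±_; ⊥±≤_; ≤±-trans) renaming ([_] to ≤[_])

  xs : ℕ → Maybe Carrier
  xs = proj₁ enumeration

  em? : ∀ {P : Subset L} → Decidable P
  em? _ = em

  ↑_ ↓_ : Subset L → Subset L
  (↑ S) x = ∃ λ s → S s × s ≤ x
  (↓ S) x = ∃ λ s → S s × x ≤ s

  private
    module Lower  = RunningMeet lattice± [_] ⊤± xs
    -- A running meet in the dual lattice is a running join in lattice±.
    module Upper  = RunningMeet (LatticeProperties.∧-∨-lattice lattice±) [_] ⊥± xs
    module Clamp± = Clamp lattice±

  lower upper select : Subset L → ℕ → Carrier ±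
  lower S  = Lower.runningMeet {P = ↑ S} em?
  upper S  = Upper.runningMeet {P = ↓ S} em?
  select S = Clamp±.clampIterate ⊥± (lower S) (upper S)

  select-monotonic : ∀ (X Y : CL L) → _⊑_ L X Y → ∀ k → select (proj₁ X) k ≤± select (proj₁ Y) k
  select-monotonic (X , _) (Y , _) (X≤Y , Y≥X) = Clamp±.clampIterate-monotonic (⊥±≤ ⊥±)
    (Lower.runningMeet-antitone em? em? ↑Y⊆↑X)
    (Upper.runningMeet-antitone em? em? ↓X⊆↓Y)
    where
    ↑Y⊆↑X : ↑ Y ⊆ ↑ X
    ↑Y⊆↑X (y , Yy , y≤z) = let x , Xx , x≤y = Y≥X y Yy in x , Xx , trans x≤y y≤z
    ↓X⊆↓Y : ↓ X ⊆ ↓ Y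
    ↓X⊆↓Y (x , Xx , z≤x) = let y , Yy , x≤y = X≤Y x Xx in y , Yy , trans z≤x x≤y

  ↑± ↓± Lift± : Subset L → Carrier ± → Set
  ↑± S ⊥±    = ⊥
  ↑± S [ a ] = (↑ S) a
  ↑± S ⊤±    = ⊤
  ↓± S ⊥±    = ⊤
  ↓± S [ b ] = (↓ S) b
  ↓± S ⊤±    = ⊥
  Lift± S ⊥±    = ⊥
  Lift± S [ x ] = S x
  Lift± S ⊤±    = ⊥

  element : ∀ {S} p → Lift± S p → Carrier
  element [ x ] _ = x

  element-∈ : ∀ {S} p (Sp : Lift± S p) → S (element p Sp)
  element-∈ [ x ] Sx = Sx

  element-≤ : ∀ {S T p q} (Sp : Lift± S p) (Tq : Lift± T q) → p ≤± q → element p Sp ≤ element q Tq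
  element-≤ {p = [ x ]} {[ y ]} _ _ ≤[ x≤y ] = x≤y

  record Anchor (S : Subset L) : Set where
    field
      index      : ℕ
      point      : Carrier
      enumerated : xs index ≡ just point
      member     : S point

  module _ {S : Subset L} (C : IsConvexSublattice L S) where
    open IsConvexSublattice C

    lower-↑± : ∀ k → ↑± S (lower S k)
    lower-↑± = Lower.runningMeet-induction em? (↑± S) _ step
      where
      step : ∀ {m x} → ↑± S m → (↑ S) x → ↑± S (m ∧± [ x ])
      step {⊤±}    _              ↑x             = ↑x
      step {[ a ]} (s , Ss , s≤a) (t , St , t≤x) =
        s ∧ t , ∧-closed Ss St , ∧-greatest (trans (x∧y≤x s t) s≤a) (trans (x∧y≤y s t) t≤x)

    upper-↓± : ∀ k → ↓± S (upper S k)
    upper-↓± = Upper.runningMeet-induction em? (↓± S) _ step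
      where
      step : ∀ {m x} → ↓± S m → (↓ S) x → ↓± S (m ∨± [ x ])
      step {⊥±}    _              ↓x             = ↓x
      step {[ b ]} (s , Ss , b≤s) (t , St , x≤t) =
        s ∨ t , ∨-closed Ss St , ∨-least (trans b≤s (x≤x∨y s t)) (trans x≤t (y≤x∨y s t))

    ↑±-lift : ∀ {y l} → S y → ↑± S l → l ≤± [ y ] → Lift± S l
    ↑±-lift Sy (s , Ss , s≤a) ≤[ a≤y ] = convex Ss Sy s≤a a≤y

    ↓±-lift : ∀ {y u} → S y → ↓± S u → [ y ] ≤± u → Lift± S u
    ↓±-lift Sy (s , Ss , b≤s) ≤[ y≤b ] = convex Sy Ss y≤b b≤s

    Lift±-convex : ∀ {l u p} → Lift± S l → Lift± S u → l ≤± p → p ≤± u → Lift± S p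
    Lift±-convex Sa Sb ≤[ a≤x ] ≤[ x≤b ] = convex Sa Sb a≤x x≤b

    anchor : Anchor S
    anchor =
      let s , Ss = nonempty
          n , y , xsₙ≡y , y≈s = proj₂ enumeration s
      in record { index = n ; point = y ; enumerated = xsₙ≡y
                ; member = convex Ss Ss (reflexive (Eq.sym y≈s)) (reflexive y≈s) }

    module Anchored (a : Anchor S) where
      open Anchor a renaming (index to n; point to y; enumerated to xsₙ≡y; member to Sy)

      lower≤y : lower S (suc n) ≤± [ y ]
      lower≤y = Lower.runningMeet-≤ em? xsₙ≡y (y , Sy , ≤-refl)

      y≤upper : [ y ] ≤± upper S (suc n)
      y≤upper = Upper.runningMeet-≤ em? xsₙ≡y (y , Sy , ≤-refl)

      open Clamp±.Bracketed {p₀ = ⊥±} (Lower.runningMeet-decreasing em?) (Upper.runningMeet-decreasing em?)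
                            (≤±-trans trans lower≤y y≤upper)

      select-stable : ∀ {k} → suc n ≤′ k → select S k ≈± select S (suc n)
      select-stable = clampIterate-stable

      select-lift : Lift± S (select S (suc n))
      select-lift = let l≤p , p≤u = clampIterate-between ≤′-refl in
        Lift±-convex (↑±-lift Sy (lower-↑± (suc n)) lower≤y) (↓±-lift Sy (upper-↓± (suc n)) y≤upper)
                     l≤p p≤u

  anchorIndex : CL L → ℕ
  anchorIndex (_ , C) = suc (Anchor.index (anchor C))

  selection : CL L → Carrier
  selection (S , C) = element (select S (anchorIndex (S , C))) (Anchored.select-lift C (anchor C))

  selection-∈ : ∀ X → proj₁ X (selection X)
  selection-∈ (S , C) = element-∈ (select S (anchorIndex (S , C))) (Anchored.select-lift C (anchor C))

  selection-monotonic : ∀ X Y → _⊑_ L X Y → selection X ≤ selection Y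
  selection-monotonic X@(S , C) Y@(T , D) X⊑Y = element-≤ X.select-lift Y.select-lift (begin
      select S m ≈⟨ Eq±.sym (X.select-stable (≤⇒≤′ (m≤m⊔n m n))) ⟩
      select S k ≤⟨ select-monotonic X Y X⊑Y k ⟩
      select T k ≈⟨ Y.select-stable (≤⇒≤′ (m≤n⊔m m n)) ⟩
      select T n ∎)
    where
    m n k : ℕ
    m = anchorIndex X
    n = anchorIndex Y
    k = m ⊔ℕ n
    module X = Anchored C (anchor C)
    module Y = Anchored D (anchor D)
    open PartialOrderReasoning (Lattice.poset lattice±)
    open Lattice lattice± using () renaming (module Eq to Eq±)

mainTheorem6 : ExcludedMiddle 0ℓ → (L : Lattice 0ℓ 0ℓ 0ℓ) → Countable L → HasCLSP L
mainTheorem6 em L countable = selection , selection-∈ , selection-monotonic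
  where open Selection em L (countable⇒enumeration L em countable)
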